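{- For each positive integer $k$ with $M$-expansion $k=\varepsilon_1M_1+\cdots+\varepsilon_\ell M_\ell$, \[ \frac{s_k-\sigma(k)}{2}-2\varepsilon_1=s_{r(k)}, \] where $\sigma(k)=\varepsilon_1+\cdots+\varepsilon_\ell$ and $r(k)=\varepsilon_2M_1+\varepsilon_3M_2+\cdots+\varepsilon_\ell M_{\ell-1}$ (so $r(k)=0$ when $\ell=1$).
   Context: Sequence $s_n$: let $A_1=(5)$ and for $k\ge2$ let $A_k$ be the concatenation $A_{k-1},A_{k-1},(1)$; $A$ is the limiting infinite list; $a_0=0$, $a_n$ is the $n$th entry of $A$ for $n\ge1$, and $s_n=a_0+\cdots+a_n$ (so $s_0=0$). For $i\ge1$ let $M_i=2^i-1$. $M$-expansion of a positive integer $n$: let $\ell=\max\{i:n\ge M_i\}$ and write $n=M_\ell+r$ with $0\le r\le M_\ell$; if $r=0$ stop with $n=M_\ell$; if $r=M_\ell$ stop with $n=2M_\ell$; otherwise continue with $r$. This gives $n=\varepsilon_1M_1+\cdots+\varepsilon_\ell M_\ell$ with $\varepsilon_i\in\{0,1,2\}$ (digits not produced are $0$). The integer $r(k)$ (the reduction of $k$) is the integer whose $M$-digit list is the left-shift $(\varepsilon_2,\dots,\varepsilon_\ell)$ of that of $k$. -}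

module Defs where

open import Data.Nat using (ℕ; zero; suc; _+_; _*_; _∸_; _^_; _≤ᵇ_; _≡ᵇ_)
open import Data.Bool using (Bool; true; false; if_then_else_)
open import Data.List using (List; []; _∷_; _++_; drop)
open import Data.Nat.ListAction using (sum)

-- The finite lists A_k (k ≥ 1):  A_1 = (5),  A_k = A_{k-1} ++ A_{k-1} ++ (1).
-- A k is A_k for k ≥ 1 (A 0 is an unused placeholder, the empty list).
A : ℕ → List ℕ
A zero          = []
A (suc zero)    = 5 ∷ []
A (suc (suc k)) = A (suc k) ++ A (suc k) ++ (1 ∷ [])

-- 1-indexed entry of a list (0 if out of range)
entry : List ℕ → ℕ → ℕ
entry []       _             = 0
entry (x ∷ xs) zero          = 0
entry (x ∷ xs) (suc zero)    = x
entry (x ∷ xs) (suc (suc n)) = entry xs (suc n)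

-- a_0 = 0; for n ≥ 1, a_n = n-th entry of the limit list A.  A_n has length
-- 2^n - 1 ≥ n and each A_k is a prefix of A_{k+1}, so the n-th entry of A
-- equals the n-th entry of A_n.
a : ℕ → ℕ
a zero    = 0
a (suc n) = entry (A (suc n)) (suc n)

s : ℕ → ℕ
s zero    = a zero
s (suc n) = s n + a (suc n)

M : ℕ → ℕ
M i = 2 ^ i ∸ 1

-- ℓ(n) = max { i ≥ 1 : n ≥ M_i }  (for n ≥ 1); search upward from i, with fuel
ellAux : ℕ → ℕ → ℕ → ℕ
ellAux zero       i n = i
ellAux (suc fuel) i n = if M (suc i) ≤ᵇ n then ellAux fuel (suc i) n else i

ell : ℕ → ℕ
ell n = ellAux n 1 n

addAt : ℕ → ℕ → List ℕ → List ℕ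
addAt zero          v ds       = ds
addAt (suc zero)    v []       = v ∷ []
addAt (suc zero)    v (d ∷ ds) = (d + v) ∷ ds
addAt (suc (suc i)) v []       = 0 ∷ addAt (suc i) v []
addAt (suc (suc i)) v (d ∷ ds) = d ∷ addAt (suc i) v ds

-- The M-expansion algorithm (greedy), with fuel.  Result: the digit list
-- (ε_1, ..., ε_ℓ).
expandAux : ℕ → ℕ → List ℕ
expandAux zero       n = []
expandAux (suc fuel) zero = []
expandAux (suc fuel) (suc m) =
  let n = suc m
      l = ell n
      r = n ∸ M l
  in if r ≡ᵇ 0 then addAt l 1 []
     else if r ≡ᵇ M l then addAt l 2 []
     else addAt l 1 (expandAux fuel r)

digits : ℕ → List ℕ
digits n = expandAux n n

valueAux : ℕ → List ℕ → ℕ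
valueAux i []       = 0
valueAux i (e ∷ es) = e * M i + valueAux (suc i) es

value : List ℕ → ℕ
value = valueAux 1

σ : ℕ → ℕ
σ k = sum (digits k)

eps1 : ℕ → ℕ
eps1 k with digits k
... | []    = 0
... | e ∷ _ = e

red : ℕ → ℕ
red k = value (drop 1 (digits k))

-- Since A_{l+1} = A_l A_l (1) and A_l has length M_l, entries M_l + 1, ..., 2M_l of A repeat
-- entries 1, ..., M_l and entry 2M_l + 1 = M_{l+1} is 1.  This gives s(M_l + r) = s(M_l) + s(r)
-- for r ≤ M_l, and s(M_l) = 3M_l + 2.  Peeling off the top digit of an M-expansion this way
-- gives s(k) = 3k + 2σ(k), and likewise for r(k), whose digits are the left shift.  Since
-- M_{i+1} = 2M_i + 1 we have k = σ(k) + 2r(k), and the claim is then an identity between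
-- linear forms in ε_1, σ(k) and r(k).
module Submission where

open import Defs
open import Data.Nat using (ℕ; _+_; _*_; _≤_)
open import Relation.Binary.PropositionalEquality using (_≡_)

open import Data.Nat using (zero; suc; _∸_; _^_; _<_; z≤n; s≤s; _≤′_; ≤′-refl; ≤′-step; _≤ᵇ_; _≡ᵇ_)
open import Data.Nat.Properties
open import Data.Bool using (true; false; if_then_else_; T)
open import Data.List using (List; []; _∷_; _++_; drop; length)
open import Data.List.Properties using (length-++)
open import Data.Nat.ListAction using (sum)
open import Data.Product using (_×_; _,_)
open import Data.Sum using (inj₁; inj₂)
open import Data.Unit using (tt)
open import Relation.Binary.PropositionalEquality using (refl; sym; trans; cong; cong₂; subst; module ≡-Reasoning)
open import Data.Nat.Solver using (module +-*-Solver)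
open +-*-Solver

M-suc : ∀ i → M (suc i) ≡ suc (M i + M i)
M-suc i = begin
    2 * 2 ^ i ∸ 1
  ≡⟨ cong (λ x → 2 * x ∸ 1) (sym (m+[n∸m]≡n (m^n>0 2 i))) ⟩
    2 * suc (M i) ∸ 1
  ≡⟨ solve 1 (λ m → m :+ (con 1 :+ (m :+ con 0)) := con 1 :+ (m :+ m)) refl (M i) ⟩
    suc (M i + M i) ∎
  where open ≡-Reasoning

M-mono : ∀ {i j} → i ≤ j → M i ≤ M j
M-mono i≤j = ∸-monoˡ-≤ 1 (^-monoʳ-≤ 2 i≤j)

n≤M : ∀ n → n ≤ M n
n≤M zero    = z≤n
n≤M (suc n) = subst (suc n ≤_) (sym (M-suc n)) (s≤s (≤-trans (n≤M n) (m≤m+n (M n) (M n))))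

ellAux-bounds : ∀ fuel {i n} → 1 ≤ i → M i ≤ n → n < M (fuel + i) →
  1 ≤ ellAux fuel i n × M (ellAux fuel i n) ≤ n × n < M (suc (ellAux fuel i n))
ellAux-bounds zero       {i}     1≤i lo hi = 1≤i , lo , <-≤-trans hi (M-mono (n≤1+n i))
ellAux-bounds (suc fuel) {i} {n} 1≤i lo hi with M (suc i) ≤ᵇ n in eq
... | true  = ellAux-bounds fuel (m≤n⇒m≤1+n 1≤i) (≤ᵇ⇒≤ (M (suc i)) n (subst T (sym eq) tt))
                (subst (λ j → n < M j) (sym (+-suc fuel i)) hi)
... | false = 1≤i , lo , ≰⇒> (λ le → subst T eq (≤⇒≤ᵇ le))

ell-bounds : ∀ n → 1 ≤ n → 1 ≤ ell n × M (ell n) ≤ n × n < M (suc (ell n))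
ell-bounds n 1≤n = ellAux-bounds n ≤-refl 1≤n (<-≤-trans (m<m+n n ≤-refl) (n≤M (n + 1)))

entry-++ˡ : ∀ xs ys {n} → n ≤ length xs → entry (xs ++ ys) n ≡ entry xs n
entry-++ˡ []       []       z≤n                  = refl
entry-++ˡ []       (y ∷ ys) z≤n                  = refl
entry-++ˡ (x ∷ xs) ys {zero}        _            = refl
entry-++ˡ (x ∷ xs) ys {suc zero}    _            = refl
entry-++ˡ (x ∷ xs) ys {suc (suc n)} (s≤s 1+n≤∣xs∣) = entry-++ˡ xs ys 1+n≤∣xs∣

entry-++ʳ : ∀ xs ys n → entry (xs ++ ys) (suc (length xs + n)) ≡ entry ys (suc n)
entry-++ʳ []       ys n = refl
entry-++ʳ (x ∷ xs) ys n = entry-++ʳ xs ys n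

length-A : ∀ l → length (A (suc l)) ≡ M (suc l)
length-A zero    = refl
length-A (suc l) = begin
    length (A (suc l) ++ A (suc l) ++ 1 ∷ [])
  ≡⟨ length-++ (A (suc l)) ⟩
    length (A (suc l)) + length (A (suc l) ++ 1 ∷ [])
  ≡⟨ cong (length (A (suc l)) +_) (length-++ (A (suc l))) ⟩
    length (A (suc l)) + (length (A (suc l)) + 1)
  ≡⟨ cong (λ m → m + (m + 1)) (length-A l) ⟩
    M (suc l) + (M (suc l) + 1)
  ≡⟨ solve 1 (λ m → m :+ (m :+ con 1) := con 1 :+ (m :+ m)) refl (M (suc l)) ⟩
    suc (M (suc l) + M (suc l))
  ≡⟨ sym (M-suc (suc l)) ⟩
    M (suc (suc l)) ∎
  where open ≡-Reasoning

entry-A-stable : ∀ {j k n} → j ≤′ k → n ≤ M (suc j) → entry (A (suc k)) n ≡ entry (A (suc j)) n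
entry-A-stable ≤′-refl           _      = refl
entry-A-stable {j} {suc k} {n} (≤′-step j≤k) bound = trans
  (entry-++ˡ (A (suc k)) (A (suc k) ++ 1 ∷ [])
    (subst (n ≤_) (sym (length-A k)) (≤-trans bound (M-mono (s≤s (≤′⇒≤ j≤k))))))
  (entry-A-stable j≤k bound)

a-entry : ∀ j {n} → n ≤ M (suc j) → a n ≡ entry (A (suc j)) n
a-entry j {zero}  _   with A (suc j)
... | []    = refl
... | _ ∷ _ = refl
a-entry j {suc n} bound with ≤-total n j
... | inj₁ n≤j = sym (entry-A-stable (≤⇒≤′ n≤j) (n≤M (suc n)))
... | inj₂ j≤n = entry-A-stable (≤⇒≤′ j≤n) bound

module _ (l : ℕ) where
  private
    B : List ℕ
    B = A (suc l)

    m : ℕ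
    m = M (suc l)

    ∣B∣≡m : length B ≡ m
    ∣B∣≡m = length-A l

  a-shift : ∀ {r} → suc r ≤ m → a (m + suc r) ≡ a (suc r)
  a-shift {r} r<m = begin
      a (m + suc r)
    ≡⟨ a-entry (suc l) (subst (m + suc r ≤_) (sym (M-suc (suc l))) m+r<) ⟩
      entry (B ++ B ++ 1 ∷ []) (m + suc r)
    ≡⟨ cong (entry (B ++ B ++ 1 ∷ [])) (trans (+-suc m r) (cong (λ x → suc (x + r)) (sym ∣B∣≡m))) ⟩
      entry (B ++ B ++ 1 ∷ []) (suc (length B + r))
    ≡⟨ entry-++ʳ B (B ++ 1 ∷ []) r ⟩
      entry (B ++ 1 ∷ []) (suc r)
    ≡⟨ entry-++ˡ B (1 ∷ []) (subst (suc r ≤_) (sym ∣B∣≡m) r<m) ⟩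
      entry B (suc r)
    ≡⟨ sym (a-entry l r<m) ⟩
      a (suc r) ∎
    where
    open ≡-Reasoning
    m+r< : m + suc r ≤ suc (m + m)
    m+r< = subst (_≤ suc (m + m)) (sym (+-suc m r)) (s≤s (+-monoʳ-≤ m (<⇒≤ r<m)))

  a[1+m+m]≡1 : a (suc (m + m)) ≡ 1
  a[1+m+m]≡1 = begin
      a (suc (m + m))
    ≡⟨ a-entry (suc l) (≤-reflexive (sym (M-suc (suc l)))) ⟩
      entry (B ++ B ++ 1 ∷ []) (suc (m + m))
    ≡⟨ cong (λ x → entry (B ++ B ++ 1 ∷ []) (suc (x + m))) (sym ∣B∣≡m) ⟩
      entry (B ++ B ++ 1 ∷ []) (suc (length B + m))
    ≡⟨ entry-++ʳ B (B ++ 1 ∷ []) m ⟩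
      entry (B ++ 1 ∷ []) (suc m)
    ≡⟨ cong (λ x → entry (B ++ 1 ∷ []) (suc x)) (trans (sym ∣B∣≡m) (sym (+-identityʳ (length B)))) ⟩
      entry (B ++ 1 ∷ []) (suc (length B + 0))
    ≡⟨ entry-++ʳ B (1 ∷ []) 0 ⟩
      1 ∎
    where open ≡-Reasoning

  s-+ : ∀ {r} → r ≤ m → s (m + r) ≡ s m + s r
  s-+ {zero}  _   = trans (cong s (+-identityʳ m)) (sym (+-identityʳ (s m)))
  s-+ {suc r} r<m = begin
      s (m + suc r)
    ≡⟨ cong s (+-suc m r) ⟩
      s (m + r) + a (suc (m + r))
    ≡⟨ cong₂ _+_ (s-+ (≤-trans (n≤1+n r) r<m)) (trans (cong a (sym (+-suc m r))) (a-shift r<m)) ⟩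
      (s m + s r) + a (suc r)
    ≡⟨ +-assoc (s m) (s r) (a (suc r)) ⟩
      s m + s (suc r) ∎
    where open ≡-Reasoning

s-M : ∀ l → s (M (suc l)) ≡ 2 + 3 * M (suc l)
s-M zero    = refl
s-M (suc l) = begin
    s (M (suc (suc l)))
  ≡⟨ cong s (M-suc (suc l)) ⟩
    s (m + m) + a (suc (m + m))
  ≡⟨ cong₂ _+_ (s-+ l ≤-refl) (a[1+m+m]≡1 l) ⟩
    (s m + s m) + 1
  ≡⟨ cong (λ x → (x + x) + 1) (s-M l) ⟩
    ((2 + 3 * m) + (2 + 3 * m)) + 1
  ≡⟨ solve 1 (λ m → ((con 2 :+ con 3 :* m) :+ (con 2 :+ con 3 :* m)) :+ con 1
                     := con 2 :+ con 3 :* (con 1 :+ (m :+ m))) refl m ⟩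
    2 + 3 * suc (m + m)
  ≡⟨ cong (λ x → 2 + 3 * x) (sym (M-suc (suc l))) ⟩
    2 + 3 * M (suc (suc l)) ∎
  where
  open ≡-Reasoning
  m : ℕ
  m = M (suc l)

sum-addAt : ∀ i v ds → sum (addAt (suc i) v ds) ≡ v + sum ds
sum-addAt zero    v []       = refl
sum-addAt zero    v (d ∷ ds) = solve 3 (λ d v σ → (d :+ v) :+ σ := v :+ (d :+ σ)) refl d v (sum ds)
sum-addAt (suc i) v []       = sum-addAt i v []
sum-addAt (suc i) v (d ∷ ds) = trans (cong (d +_) (sum-addAt i v ds))
  (solve 3 (λ d v σ → d :+ (v :+ σ) := v :+ (d :+ σ)) refl d v (sum ds))

valueAux-addAt : ∀ i j v ds → valueAux j (addAt (suc i) v ds) ≡ v * M (i + j) + valueAux j ds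
valueAux-addAt zero    j v []       = refl
valueAux-addAt zero    j v (d ∷ ds) =
  solve 4 (λ d v m x → (d :+ v) :* m :+ x := v :* m :+ (d :* m :+ x)) refl d v (M j) (valueAux (suc j) ds)
valueAux-addAt (suc i) j v []       =
  trans (valueAux-addAt i (suc j) v []) (cong (λ x → v * M x + 0) (+-suc i j))
valueAux-addAt (suc i) j v (d ∷ ds) = begin
    d * M j + valueAux (suc j) (addAt (suc i) v ds)
  ≡⟨ cong (d * M j +_) (valueAux-addAt i (suc j) v ds) ⟩
    d * M j + (v * M (i + suc j) + valueAux (suc j) ds)
  ≡⟨ cong (λ x → d * M j + (v * M x + valueAux (suc j) ds)) (+-suc i j) ⟩
    d * M j + (v * M (suc (i + j)) + valueAux (suc j) ds)
  ≡⟨ solve 5 (λ d v m m′ x → d :* m :+ (v :* m′ :+ x) := v :* m′ :+ (d :* m :+ x))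
       refl d v (M j) (M (suc (i + j))) (valueAux (suc j) ds) ⟩
    v * M (suc (i + j)) + (d * M j + valueAux (suc j) ds) ∎
  where open ≡-Reasoning

value-addAt : ∀ i v ds → value (addAt (suc i) v ds) ≡ v * M (suc i) + value ds
value-addAt i v ds = trans (valueAux-addAt i 1 v ds) (cong (λ x → v * M x + value ds) (+-comm i 1))

valueAux-suc : ∀ j ds → valueAux (suc j) ds ≡ 2 * valueAux j ds + sum ds
valueAux-suc j []       = refl
valueAux-suc j (e ∷ es) = begin
    e * M (suc j) + valueAux (suc (suc j)) es
  ≡⟨ cong₂ (λ x y → e * x + y) (M-suc j) (valueAux-suc (suc j) es) ⟩
    e * suc (M j + M j) + (2 * valueAux (suc j) es + sum es)
  ≡⟨ solve 4 (λ e m v σ → e :* (con 1 :+ (m :+ m)) :+ (con 2 :* v :+ σ)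
                         := con 2 :* (e :* m :+ v) :+ (e :+ σ)) refl e (M j) (valueAux (suc j) es) (sum es) ⟩
    2 * (e * M j + valueAux (suc j) es) + (e + sum es) ∎
  where open ≡-Reasoning

value-drop : ∀ ds → value ds ≡ sum ds + 2 * value (drop 1 ds)
value-drop []       = refl
value-drop (e ∷ es) =
  trans (cong (e * 1 +_) (valueAux-suc 1 es))
    (solve 3 (λ e v σ → e :* con 1 :+ (con 2 :* v :+ σ) := (e :+ σ) :+ con 2 :* v) refl e (value es) (sum es))

value-drop-≤ : ∀ i ds → value ds ≤ M (suc i) → value (drop 1 ds) ≤ M i
value-drop-≤ i ds bound = ≤-pred (*-cancelˡ-< 2 (value (drop 1 ds)) (suc (M i)) (s≤s (begin
    2 * value (drop 1 ds)
  ≤⟨ m≤n+m _ (sum ds) ⟩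
    sum ds + 2 * value (drop 1 ds)
  ≡⟨ sym (value-drop ds) ⟩
    value ds
  ≤⟨ bound ⟩
    M (suc i)
  ≡⟨ M-suc i ⟩
    suc (M i + M i)
  ≡⟨ solve 1 (λ m → con 1 :+ (m :+ m) := m :+ con 1 :* (con 1 :+ m)) refl (M i) ⟩
    M i + 1 * suc (M i) ∎)))
  where open ≤-Reasoning

-- Digit lists built from the top digit down as the greedy algorithm does.  The bound on the
-- tail is what makes s additive at each step, and it survives the left shift.
data Expansion : List ℕ → Set where
  []    : Expansion []
  twice : ∀ l → Expansion (addAt (suc l) 2 [])
  once  : ∀ l {ds} → value ds ≤ M (suc l) → Expansion ds → Expansion (addAt (suc l) 1 ds)

Expansion-drop : ∀ {ds} → Expansion ds → Expansion (drop 1 ds)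
Expansion-drop []                            = []
Expansion-drop (twice zero)                  = []
Expansion-drop (twice (suc l))               = twice l
Expansion-drop (once zero {[]} _ _)          = []
Expansion-drop (once zero {_ ∷ _} _ e)       = Expansion-drop e
Expansion-drop (once (suc l) {[]} _ _)       = once l z≤n []
Expansion-drop (once (suc l) {d ∷ ds} bound e) =
  once l (value-drop-≤ (suc l) (d ∷ ds) bound) (Expansion-drop e)

s-value : ∀ {ds} → Expansion ds → s (value ds) ≡ 3 * value ds + 2 * sum ds
s-value [] = refl
s-value (twice l) = begin
    s (value (addAt (suc l) 2 []))
  ≡⟨ cong s (trans (value-addAt l 2 []) (solve 1 (λ m → con 2 :* m :+ con 0 := m :+ m) refl m)) ⟩
    s (m + m)
  ≡⟨ s-+ l ≤-refl ⟩
    s m + s m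
  ≡⟨ cong (λ x → x + x) (s-M l) ⟩
    (2 + 3 * m) + (2 + 3 * m)
  ≡⟨ solve 1 (λ m → (con 2 :+ con 3 :* m) :+ (con 2 :+ con 3 :* m)
                   := con 3 :* (con 2 :* m :+ con 0) :+ con 2 :* (con 2 :+ con 0)) refl m ⟩
    3 * (2 * m + 0) + 2 * (2 + 0)
  ≡⟨ sym (cong₂ (λ v σ → 3 * v + 2 * σ) (value-addAt l 2 []) (sum-addAt l 2 [])) ⟩
    3 * value (addAt (suc l) 2 []) + 2 * sum (addAt (suc l) 2 []) ∎
  where
  open ≡-Reasoning
  m : ℕ
  m = M (suc l)
s-value (once l {ds} bound e) = begin
    s (value (addAt (suc l) 1 ds))
  ≡⟨ cong s (trans (value-addAt l 1 ds) (cong (_+ value ds) (*-identityˡ m))) ⟩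
    s (m + value ds)
  ≡⟨ s-+ l bound ⟩
    s m + s (value ds)
  ≡⟨ cong₂ _+_ (s-M l) (s-value e) ⟩
    (2 + 3 * m) + (3 * value ds + 2 * sum ds)
  ≡⟨ solve 3 (λ m v σ → (con 2 :+ con 3 :* m) :+ (con 3 :* v :+ con 2 :* σ)
                       := con 3 :* (con 1 :* m :+ v) :+ con 2 :* (con 1 :+ σ)) refl m (value ds) (sum ds) ⟩
    3 * (1 * m + value ds) + 2 * (1 + sum ds)
  ≡⟨ sym (cong₂ (λ v σ → 3 * v + 2 * σ) (value-addAt l 1 ds) (sum-addAt l 1 ds)) ⟩
    3 * value (addAt (suc l) 1 ds) + 2 * sum (addAt (suc l) 1 ds) ∎
  where
  open ≡-Reasoning
  m : ℕ
  m = M (suc l)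

IsExpansionOf : ℕ → List ℕ → Set
IsExpansionOf n ds = Expansion ds × value ds ≡ n

greedyStep : ℕ → ℕ → List ℕ → List ℕ
greedyStep l r ds = if r ≡ᵇ 0 then addAt l 1 [] else if r ≡ᵇ M l then addAt l 2 [] else addAt l 1 ds

greedyStep-IsExpansionOf : ∀ l r {ds} → r ≤ M l → IsExpansionOf r ds →
  IsExpansionOf (M l + r) (greedyStep l r ds)
greedyStep-IsExpansionOf zero    zero    _ _ = [] , refl
greedyStep-IsExpansionOf (suc l) zero    _ _ =
  once l z≤n [] , trans (value-addAt l 1 []) (cong (_+ 0) (*-identityˡ (M (suc l))))
greedyStep-IsExpansionOf (suc l) (suc r) {ds} r≤m (e , v≡r) with suc r ≡ᵇ M (suc l) in eq
... | true  = twice l , (begin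
    value (addAt (suc l) 2 [])
  ≡⟨ value-addAt l 2 [] ⟩
    2 * M (suc l) + 0
  ≡⟨ solve 1 (λ m → con 2 :* m :+ con 0 := m :+ m) refl (M (suc l)) ⟩
    M (suc l) + M (suc l)
  ≡⟨ cong (M (suc l) +_) (sym (≡ᵇ⇒≡ (suc r) (M (suc l)) (subst T (sym eq) tt))) ⟩
    M (suc l) + suc r ∎)
  where open ≡-Reasoning
... | false = once l (subst (_≤ M (suc l)) (sym v≡r) r≤m) e ,
  trans (value-addAt l 1 ds) (cong₂ _+_ (*-identityˡ (M (suc l))) v≡r)

expandAux-IsExpansionOf : ∀ fuel n → n ≤ fuel → IsExpansionOf n (expandAux fuel n)
expandAux-IsExpansionOf zero       zero    _ = [] , refl
expandAux-IsExpansionOf (suc fuel) zero    _ = [] , refl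
expandAux-IsExpansionOf (suc fuel) (suc k) (s≤s k≤fuel) with ell-bounds (suc k) (s≤s z≤n)
... | 1≤l , lo , hi = subst (λ n → IsExpansionOf n (expandAux (suc fuel) (suc k))) (m+[n∸m]≡n lo)
        (greedyStep-IsExpansionOf l r r≤M (expandAux-IsExpansionOf fuel r r≤fuel))
  where
  l r : ℕ
  l = ell (suc k)
  r = suc k ∸ M l
  r≤M : r ≤ M l
  r≤M = subst (r ≤_) (m+n∸m≡n (M l) (M l))
          (∸-monoˡ-≤ (M l) (≤-pred (subst (suc k <_) (M-suc l) hi)))
  r≤fuel : r ≤ fuel
  r≤fuel = ≤-trans (∸-monoʳ-≤ (suc k) (≤-trans 1≤l (n≤M l))) k≤fuel

digits-IsExpansionOf : ∀ k → IsExpansionOf k (digits k)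
digits-IsExpansionOf k = expandAux-IsExpansionOf k k ≤-refl

s-value-∷ : ∀ {e es} → Expansion (e ∷ es) →
  s (value (e ∷ es)) ≡ sum (e ∷ es) + 2 * (2 * e + s (value es))
s-value-∷ {e} {es} ex = begin
    s (value (e ∷ es))
  ≡⟨ s-value ex ⟩
    3 * value (e ∷ es) + 2 * (e + sum es)
  ≡⟨ cong (λ v → 3 * v + 2 * (e + sum es)) (value-drop (e ∷ es)) ⟩
    3 * ((e + sum es) + 2 * value es) + 2 * (e + sum es)
  ≡⟨ solve 3 (λ e σ v → con 3 :* ((e :+ σ) :+ con 2 :* v) :+ con 2 :* (e :+ σ)
                       := (e :+ σ) :+ con 2 :* (con 2 :* e :+ (con 3 :* v :+ con 2 :* σ)))
       refl e (sum es) (value es) ⟩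
    (e + sum es) + 2 * (2 * e + (3 * value es + 2 * sum es))
  ≡⟨ cong (λ x → (e + sum es) + 2 * (2 * e + x)) (sym (s-value (Expansion-drop ex))) ⟩
    sum (e ∷ es) + 2 * (2 * e + s (value es)) ∎
  where open ≡-Reasoning

lemma2p3 : (k : ℕ) → 1 ≤ k → s k ≡ σ k + 2 * (2 * eps1 k + s (red k))
lemma2p3 k _ with digits k | digits-IsExpansionOf k
... | []     | _  , value≡k = subst (λ n → s n ≡ 0) value≡k refl
... | e ∷ es | ex , value≡k =
  subst (λ n → s n ≡ sum (e ∷ es) + 2 * (2 * e + s (value es))) value≡k (s-value-∷ ex)
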